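{- For every $\gamma,q\in(0,1)$ and every integer $\alpha\geq2$, it holds that $\mathcal{F}_{\alpha}\nsubseteq(\tilde{\mathcal{F}}_{\gamma}\cup\mathcal{F}_{q})$.
   Context: All functions are set functions $f\colon 2^{U}\to\mathbb{R}_{\geq0}$ on some finite ground set $U$; $f$ is monotone if $X\subseteq Y$ implies $f(X)\leq f(Y)$. Write $[n]=\{1,\dots,n\}$. The greedy algorithm produces $x_1,x_2,\dots$ with $x_i\in\arg\max_{x\in U\setminus\{x_1,\dots,x_{i-1}\}} f(\{x_1,\dots,x_{i-1}\}\cup\{x\})$, and $S^{G}_i=\{x_1,\dots,x_i\}$, $S^{G}_0=\emptyset$; ties are broken by some rule, and each function is considered together with a fixed such greedy run, to which all notions referring to greedy sets refer. $\bar{k}\in[|U|]$ is the smallest index such that $f(S^{G}_{\bar k}\cup\{x\})=f(S^{G}_{\bar k})$ for all $x\in U\setminus S^{G}_{\bar k}$. Weak submodularity ratio: $\gamma(f)=\min_{X\in\{S^{G}_0,\dots,S^{G}_{\bar k}\},\,Y\subseteq U\setminus X}\frac{\sum_{y\in Y}(f(X\cup\{y\})-f(X))}{f(X\cup Y)-f(X)}$ with $\frac00:=1$. $\tilde{\mathcal{F}}_{\gamma}$ is the set of all monotone $f$ with $\gamma(f)\geq\gamma$. For $\alpha\geq1$, $f$ is $\alpha$-augmentable if for all $X\subseteq U$ and $Y\subseteq U$ with $Y\nsubseteq X$ there is $y\in Y\setminus X$ with $f(X\cup\{y\})-f(X)\geq\frac{f(X\cup Y)-\alpha f(X)}{|Y|}$.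 $\mathcal{F}_{\alpha}$ is the set of monotone $\alpha$-augmentable functions. An independence system $(U,\mathcal{I})$ has $\emptyset\in\mathcal{I}\subseteq 2^U$ with $\mathcal{I}$ closed under subsets. For $w\colon U\to\mathbb{R}_{\geq0}$ its weighted rank function is $f(X)=\max\{\sum_{x\in Y}w(x)\mid Y\in\mathcal{I}\cap 2^{X}\}$. The bases $\mathcal{B}(X)$ of $X$ are the inclusion-wise maximal sets of $\mathcal{I}\cap2^X$; the rank quotient is $q(U,\mathcal{I})=\min_{X\subseteq U}\min_{B,B'\in\mathcal{B}(X)}|B|/|B'|$ with $\frac00:=1$. $\mathcal{F}_q$ is the set of weighted rank functions of independence systems with rank quotient at least $q$.
   Formalization: The parameters γ and q range over the rationals in (0,1) rather than the reals, and the values of f and the weights w of weighted rank functions are taken in the rationals. -}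

module Defs where

open import Data.Bool using (Bool; true; false; T; if_then_else_)
open import Data.Nat as ℕ using (ℕ; zero; suc)
open import Data.Integer using (+_)
open import Data.Rational
  using (ℚ; 0ℚ; 1ℚ; _+_; _-_; _*_; _≤_; _<_; _÷_; _≟_; ≢-nonZero)
  renaming (_/_ to _//_)
open import Data.Fin using (Fin; toℕ) renaming (zero to fzero; suc to fsuc)
open import Data.Fin.Subset
  using (Subset; _∈_; _∉_; _⊆_; _∪_; ⁅_⁆; ⊥; ∁; ∣_∣)
open import Data.Vec using ([]; _∷_)
open import Data.List using (List; length; take; foldr; lookup)
open import Data.List.Relation.Unary.Unique.Propositional using (Unique)
open import Data.Product using (Σ; _×_; _,_)
open import Relation.Binary.PropositionalEquality using (_≡_)
open import Relation.Nullary using (¬_; yes; no)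

SetFun : ℕ → Set
SetFun n = Subset n → ℚ

sumOver : ∀ {n} → Subset n → (Fin n → ℚ) → ℚ
sumOver []          g = 0ℚ
sumOver (b ∷ bs)    g = (if b then g fzero else 0ℚ) + sumOver bs (λ i → g (fsuc i))

ℕtoℚ : ℕ → ℚ
ℕtoℚ k = (+ k) // 1

-- quotient a/b with the convention 0/0 := 1 (for b = 0 we return 1;
-- in all uses below b = 0 forces a = 0)
ratio : ℚ → ℚ → ℚ
ratio a b with b ≟ 0ℚ
... | yes _  = 1ℚ
... | no b≢0 = _÷_ a b {{≢-nonZero b≢0}}

NonNeg : ∀ {n} → SetFun n → Set
NonNeg f = ∀ X → 0ℚ ≤ f X

Monotone : ∀ {n} → SetFun n → Set
Monotone f = ∀ X Y → X ⊆ Y → f X ≤ f Y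

prefixSet : ∀ {n} → List (Fin n) → ℕ → Subset n
prefixSet xs i = foldr (λ x s → ⁅ x ⁆ ∪ s) ⊥ (take i xs)

-- A full greedy run x_1, ..., x_n (n = |U|) of f: all elements distinct, and
-- x_{i+1} maximises f(S_i ∪ {x}) over x ∈ U ∖ S_i  (ties broken arbitrarily).
record GreedyRun {n : ℕ} (f : SetFun n) : Set where
  field
    run      : List (Fin n)
    len      : length run ≡ n
    distinct : Unique run
    greedy   : ∀ (i : Fin (length run)) (x : Fin n) → x ∉ prefixSet run (toℕ i) →
               f (prefixSet run (toℕ i) ∪ ⁅ x ⁆)
                 ≤ f (prefixSet run (toℕ i) ∪ ⁅ lookup run i ⁆)
open GreedyRun public

SG : ∀ {n} {f : SetFun n} → GreedyRun f → ℕ → Subset n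
SG r i = prefixSet (run r) i

Saturated : ∀ {n} (f : SetFun n) → GreedyRun f → ℕ → Set
Saturated {n} f r k = ∀ (x : Fin n) → x ∉ SG r k → f (SG r k ∪ ⁅ x ⁆) ≡ f (SG r k)

IsKbar : ∀ {n} (f : SetFun n) → GreedyRun f → ℕ → Set
IsKbar {n} f r k =
  (1 ℕ.≤ k) × (k ℕ.≤ n) × Saturated f r k ×
  (∀ j → 1 ℕ.≤ j → j ℕ.< k → ¬ Saturated f r j)

-- Weak submodularity ratio: γ(f) ≥ γ unfolds to: every ratio in the min is ≥ γ.

WSRatioAtLeast : ∀ {n} (f : SetFun n) → GreedyRun f → ℚ → Set
WSRatioAtLeast {n} f r γ =
  ∀ kbar → IsKbar f r kbar → ∀ i → i ℕ.≤ kbar → ∀ (Y : Subset n) → Y ⊆ ∁ (SG r i) →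
    γ ≤ ratio (sumOver Y (λ y → f (SG r i ∪ ⁅ y ⁆) - f (SG r i)))
              (f (SG r i ∪ Y) - f (SG r i))

InTildeF : ∀ {n} → ℚ → (f : SetFun n) → GreedyRun f → Set
InTildeF γ f r = NonNeg f × Monotone f × WSRatioAtLeast f r γ

-- α-augmentability (the inequality multiplied through by |Y| > 0)

Augmentable : ∀ {n} → ℚ → SetFun n → Set
Augmentable {n} α f =
  ∀ (X Y : Subset n) → ¬ (Y ⊆ X) →
    Σ (Fin n) λ y → y ∈ Y × y ∉ X ×
      (f (X ∪ Y) - α * f X ≤ ℕtoℚ ∣ Y ∣ * (f (X ∪ ⁅ y ⁆) - f X))

InFα : ∀ {n} → ℚ → SetFun n → Set
InFα α f = NonNeg f × Monotone f × Augmentable α f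

record IndepSystem (n : ℕ) : Set where
  field
    indep      : Subset n → Bool
    empty-ind  : T (indep ⊥)
    down-close : ∀ X Y → X ⊆ Y → T (indep Y) → T (indep X)
open IndepSystem public

IsWeightedRank : ∀ {n} → IndepSystem n → (Fin n → ℚ) → SetFun n → Set
IsWeightedRank {n} I w f =
  ∀ (X : Subset n) →
    (Σ (Subset n) λ Y → Y ⊆ X × T (indep I Y) × f X ≡ sumOver Y w) ×
    (∀ (Y : Subset n) → Y ⊆ X → T (indep I Y) → sumOver Y w ≤ f X)

IsBasis : ∀ {n} → IndepSystem n → Subset n → Subset n → Set
IsBasis {n} I X B =
  B ⊆ X × T (indep I B) × (∀ (Z : Subset n) → B ⊆ Z → Z ⊆ X → T (indep I Z) → Z ≡ B)

cardRatio : ℕ → ℕ → ℚ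
cardRatio a zero    = 1ℚ
cardRatio a (suc b) = (+ a) // suc b

-- q(U, I) ≥ q : every ratio in the min is ≥ q
RankQuotientAtLeast : ∀ {n} → IndepSystem n → ℚ → Set
RankQuotientAtLeast {n} I q =
  ∀ (X B B' : Subset n) → IsBasis I X B → IsBasis I X B' → q ≤ cardRatio ∣ B ∣ ∣ B' ∣

InFq : ∀ {n} → ℚ → SetFun n → Set
InFq {n} q f =
  Σ (IndepSystem n) λ I → Σ (Fin n → ℚ) λ w →
    (∀ x → 0ℚ ≤ w x) × RankQuotientAtLeast I q × IsWeightedRank I w f

-- The counterexample lives on three elements: f ∅ = 0, f U = 2 and f X = 1 otherwise.
-- It is 2-augmentable (an exhaustive check), hence α-augmentable for every α ≥ 2, since on a
-- nonnegative function the augmentability inequality only weakens as α grows.  Once greedy has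
-- picked one element, each remaining element gains nothing while the remaining pair gains 1, so
-- the weak submodularity ratio is 0.  Finally f is not a weighted rank function of any
-- independence system, whatever its rank quotient: the singletons force all weights to be 1, so
-- f U = 2 is attained on an independent pair Y, whose own value would then be at least 2,
-- whereas f Y = 1.
module Submission where

open import Defs
open import Data.Nat using (ℕ; _≤_)
open import Data.Rational using (ℚ; 0ℚ; 1ℚ; _<_)
open import Data.Product using (Σ; _×_)
open import Relation.Nullary using (¬_)

open import Data.Bool using (true; false)
open import Data.Empty using (⊥-elim)
import Data.Fin
open import Data.Fin using (Fin; toℕ) renaming (zero to fzero; suc to fsuc)
open import Data.Fin.Properties using (any?; all?)
open import Data.Fin.Subset using (Subset; _∈_; _∉_; _⊆_; _∪_; ⁅_⁆; ∁; ⊤; ⊥; ∣_∣)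
open import Data.Fin.Subset.Properties
  using (_∈?_; _⊆?_; anySubset?; ⊆-refl; ⊆-antisym; ⊥⊆; drop-∷-⊆)
open import Data.Integer using (+_; +≤+)
import Data.Integer.Properties as ℤ
open import Data.List using (List; []; _∷_; length; lookup)
import Data.Nat as ℕ
open import Data.Nat.Divisibility using (∣1⇒≡1)
import Data.Nat.Properties as ℕ
open import Data.Product using (_,_; proj₂)
open import Data.Rational using (mkℚ; _+_; _-_; _*_; *≤*; nonNegative)
  renaming (_≤_ to _≤ℚ_)
open import Data.Rational.Properties
  using (≤-trans; <-≤-trans; <-irrefl; ≤-reflexive; _≤?_; _<?_; _≟_; normalize-coprime;
         +-identityˡ; +-identityʳ; +-monoʳ-≤; neg-antimono-≤; *-monoʳ-≤-nonNeg)
open import Data.Sum using (_⊎_; inj₁; inj₂)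
import Data.Sum
open import Data.Vec using ([]; _∷_; here)
open import Function using (_∘_)
open import Relation.Binary.PropositionalEquality using (_≡_; refl; sym; trans; cong; cong₂)
open import Relation.Nullary using (Dec; yes; no; ¬?; _×-dec_; _→-dec_)
open import Relation.Nullary.Decidable using (from-yes; decidable-stable)

allSubsets? : ∀ {n} {P : Subset n → Set} → (∀ X → Dec (P X)) → Dec (∀ X → P X)
allSubsets? P? with anySubset? (¬? ∘ P?)
... | yes (X , ¬PX) = no λ ∀P → ¬PX (∀P X)
... | no  ¬∃¬P      = yes λ X → decidable-stable (P? X) (λ ¬PX → ¬∃¬P (X , ¬PX))

nonNeg? : ∀ {n} (f : SetFun n) → Dec (NonNeg f)
nonNeg? f = allSubsets? λ X → 0ℚ ≤? f X

monotone? : ∀ {n} (f : SetFun n) → Dec (Monotone f)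
monotone? f = allSubsets? λ X → allSubsets? λ Y → (X ⊆? Y) →-dec (f X ≤? f Y)

augmentable? : ∀ {n} (α : ℚ) (f : SetFun n) → Dec (Augmentable α f)
augmentable? α f = allSubsets? λ X → allSubsets? λ Y → ¬? (Y ⊆? X) →-dec any? λ y →
  (y ∈? Y) ×-dec ¬? (y ∈? X) ×-dec
  (f (X ∪ Y) - α * f X ≤? ℕtoℚ ∣ Y ∣ * (f (X ∪ ⁅ y ⁆) - f X))

ℕtoℚ≡mkℚ : ∀ k → ℕtoℚ k ≡ mkℚ (+ k) 0 (λ (_ , d∣1) → ∣1⇒≡1 d∣1)
ℕtoℚ≡mkℚ k = normalize-coprime _

ℕtoℚ-mono-≤ : ∀ {m n} → m ≤ n → ℕtoℚ m ≤ℚ ℕtoℚ n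
ℕtoℚ-mono-≤ {m} {n} m≤n rewrite ℕtoℚ≡mkℚ m | ℕtoℚ≡mkℚ n =
  *≤* (ℤ.*-monoʳ-≤-nonNeg (+ 1) (+≤+ m≤n))

augmentable-mono : ∀ {n} {α β : ℚ} {f : SetFun n} →
                   NonNeg f → α ≤ℚ β → Augmentable α f → Augmentable β f
augmentable-mono {α = α} {β} {f} f≥0 α≤β aug X Y Y⊈X
  with aug X Y Y⊈X
... | y , y∈Y , y∉X , gain = y , y∈Y , y∉X , ≤-trans weaker gain
  where
  weaker : f (X ∪ Y) - β * f X ≤ℚ f (X ∪ Y) - α * f X
  weaker = +-monoʳ-≤ (f (X ∪ Y))
    (neg-antimono-≤ (*-monoʳ-≤-nonNeg (f X) {{nonNegative (f≥0 X)}} α≤β))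

sumOver-⊥ : ∀ {n} (g : Fin n → ℚ) → sumOver ⊥ g ≡ 0ℚ
sumOver-⊥ {ℕ.zero}  g = refl
sumOver-⊥ {ℕ.suc n} g = trans (+-identityˡ _) (sumOver-⊥ (g ∘ fsuc))

sumOver-⁅⁆ : ∀ {n} (x : Fin n) (g : Fin n → ℚ) → sumOver ⁅ x ⁆ g ≡ g x
sumOver-⁅⁆ fzero    g = trans (cong (_+_ (g fzero)) (sumOver-⊥ (g ∘ fsuc))) (+-identityʳ _)
sumOver-⁅⁆ (fsuc x) g = trans (+-identityˡ _) (sumOver-⁅⁆ x (g ∘ fsuc))

⊆⁅x⁆⇒≡⊥⊎≡⁅x⁆ : ∀ {n} {x : Fin n} {Y : Subset n} → Y ⊆ ⁅ x ⁆ → Y ≡ ⊥ ⊎ Y ≡ ⁅ x ⁆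
⊆⁅x⁆⇒≡⊥⊎≡⁅x⁆ {x = fzero}  {true  ∷ Y} Y⊆x = inj₂ (cong (true ∷_)  (⊆-antisym (drop-∷-⊆ Y⊆x) ⊥⊆))
⊆⁅x⁆⇒≡⊥⊎≡⁅x⁆ {x = fzero}  {false ∷ Y} Y⊆x = inj₁ (cong (false ∷_) (⊆-antisym (drop-∷-⊆ Y⊆x) ⊥⊆))
⊆⁅x⁆⇒≡⊥⊎≡⁅x⁆ {x = fsuc x} {true  ∷ Y} Y⊆x with Y⊆x here
... | ()
⊆⁅x⁆⇒≡⊥⊎≡⁅x⁆ {x = fsuc x} {false ∷ Y} Y⊆x =
  Data.Sum.map (cong (false ∷_)) (cong (false ∷_)) (⊆⁅x⁆⇒≡⊥⊎≡⁅x⁆ (drop-∷-⊆ Y⊆x))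

weightedRank-⁅⁆ : ∀ {n} {I : IndepSystem n} {w : Fin n → ℚ} {f : SetFun n} →
                  IsWeightedRank I w f → ∀ x → ¬ (f ⁅ x ⁆ ≡ 0ℚ) → f ⁅ x ⁆ ≡ w x
weightedRank-⁅⁆ {w = w} rank x f⁅x⁆≢0 with rank ⁅ x ⁆
... | (Y , Y⊆x , _ , f⁅x⁆≡ΣY) , _ with ⊆⁅x⁆⇒≡⊥⊎≡⁅x⁆ Y⊆x
...   | inj₁ refl = ⊥-elim (f⁅x⁆≢0 (trans f⁅x⁆≡ΣY (sumOver-⊥ w)))
...   | inj₂ refl = trans f⁅x⁆≡ΣY (sumOver-⁅⁆ x w)

weightedRank-attained : ∀ {n} {I : IndepSystem n} {w : Fin n → ℚ} {f : SetFun n} →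
                        IsWeightedRank I w f → ∀ X →
                        Σ (Subset n) λ Y → f X ≡ sumOver Y w × f X ≤ℚ f Y
weightedRank-attained rank X with rank X
... | (Y , _ , indY , fX≡ΣY) , _ =
  Y , fX≡ΣY , ≤-trans (≤-reflexive fX≡ΣY) (proj₂ (rank Y) Y ⊆-refl indY)

sumOver-cong : ∀ {n} (Y : Subset n) {g h : Fin n → ℚ} → (∀ i → g i ≡ h i) →
               sumOver Y g ≡ sumOver Y h
sumOver-cong []          g≗h = refl
sumOver-cong (true  ∷ Y) g≗h = cong₂ _+_ (g≗h fzero) (sumOver-cong Y (g≗h ∘ fsuc))
sumOver-cong (false ∷ Y) g≗h = cong (_+_ 0ℚ) (sumOver-cong Y (g≗h ∘ fsuc))

isGreedy? : ∀ {n} (f : SetFun n) (xs : List (Fin n)) →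
            Dec (∀ (i : Fin (length xs)) (x : Fin n) → x ∉ prefixSet xs (toℕ i) →
                   f (prefixSet xs (toℕ i) ∪ ⁅ x ⁆) ≤ℚ f (prefixSet xs (toℕ i) ∪ ⁅ lookup xs i ⁆))
isGreedy? f xs = all? λ i → all? λ x → ¬? (x ∈? prefixSet xs (toℕ i)) →-dec
  (f (prefixSet xs (toℕ i) ∪ ⁅ x ⁆) ≤? f (prefixSet xs (toℕ i) ∪ ⁅ lookup xs i ⁆))

saturated? : ∀ {n} (f : SetFun n) (r : GreedyRun f) k → Dec (Saturated f r k)
saturated? f r k = all? λ x → ¬? (x ∈? SG r k) →-dec (f (SG r k ∪ ⁅ x ⁆) ≟ f (SG r k))

topJump : SetFun 3
topJump (false ∷ false ∷ false ∷ []) = 0ℚ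
topJump (true  ∷ true  ∷ true  ∷ []) = ℕtoℚ 2
topJump _                            = 1ℚ

topJump-nonNeg : NonNeg topJump
topJump-nonNeg = from-yes (nonNeg? topJump)

topJump-monotone : Monotone topJump
topJump-monotone = from-yes (monotone? topJump)

topJump-augmentable : ∀ α → 2 ≤ α → Augmentable (ℕtoℚ α) topJump
topJump-augmentable α 2≤α = augmentable-mono topJump-nonNeg (ℕtoℚ-mono-≤ 2≤α)
  (from-yes (augmentable? (ℕtoℚ 2) topJump))

ascending : GreedyRun topJump
ascending = record
  { run      = order
  ; len      = refl
  ; distinct = from-yes (unique? order)
  ; greedy   = from-yes (isGreedy? topJump order)
  }
  where
  open import Data.List.Relation.Unary.Unique.DecPropositional (Data.Fin._≟_ {3}) using (unique?)
  order : List (Fin 3)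
  order = fzero ∷ fsuc fzero ∷ fsuc (fsuc fzero) ∷ []

ascending-kbar : IsKbar topJump ascending 1
ascending-kbar = ℕ.s≤s ℕ.z≤n , ℕ.s≤s ℕ.z≤n , from-yes (saturated? topJump ascending 1) ,
  λ { (ℕ.suc j) (ℕ.s≤s _) (ℕ.s≤s ()) }

topJump-not-weaklySubmodular : ∀ γ → 0ℚ < γ → ¬ WSRatioAtLeast topJump ascending γ
topJump-not-weaklySubmodular γ 0<γ ws = <-irrefl refl (<-≤-trans 0<γ γ≤0)
  where
  rest : Subset 3
  rest = false ∷ true ∷ true ∷ []
  γ≤0 : γ ≤ℚ 0ℚ
  γ≤0 = ws 1 ascending-kbar 1 ℕ.≤-refl rest (from-yes (rest ⊆? ∁ (SG ascending 1)))

topJump-not-weightedRank : ∀ {I : IndepSystem 3} {w : Fin 3 → ℚ} → ¬ IsWeightedRank I w topJump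
topJump-not-weightedRank {I} {w} rank with weightedRank-attained {I = I} rank ⊤
... | Y , top≡ΣY , top≤Y =
  <-irrefl refl (<-≤-trans (pairs-below-top Y (trans top≡ΣY (sumOver-cong Y w≗1))) top≤Y)
  where
  w≗1 : ∀ x → w x ≡ 1ℚ
  w≗1 fzero               = sym (weightedRank-⁅⁆ {I = I} rank fzero λ ())
  w≗1 (fsuc fzero)        = sym (weightedRank-⁅⁆ {I = I} rank (fsuc fzero) λ ())
  w≗1 (fsuc (fsuc fzero)) = sym (weightedRank-⁅⁆ {I = I} rank (fsuc (fsuc fzero)) λ ())
  pairs-below-top : ∀ Y → topJump ⊤ ≡ sumOver Y (λ _ → 1ℚ) → topJump Y < topJump ⊤
  pairs-below-top = from-yes (allSubsets? λ Y →
    (topJump ⊤ ≟ sumOver Y (λ _ → 1ℚ)) →-dec (topJump Y <? topJump ⊤))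

proposition14 : (γ q : ℚ) → 0ℚ < γ → γ < 1ℚ → 0ℚ < q → q < 1ℚ →
                (α : ℕ) → 2 ≤ α →
                Σ ℕ λ n → Σ (SetFun n) λ f → Σ (GreedyRun f) λ r →
                  InFα (ℕtoℚ α) f × ¬ InTildeF γ f r × ¬ InFq q f
proposition14 γ q 0<γ _ _ _ α 2≤α =
  3 , topJump , ascending ,
  (topJump-nonNeg , topJump-monotone , topJump-augmentable α 2≤α) ,
  (λ (_ , _ , ws) → topJump-not-weaklySubmodular γ 0<γ ws) ,
  (λ (I , _ , _ , _ , rank) → topJump-not-weightedRank {I} rank)
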